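{- For every GNTC formula $\varphi$, the number of elements of $\mathrm{cl}(\varphi)$ up to renaming of free variables (i.e., the number of equivalence classes of $\mathrm{cl}(\varphi)$ under renaming free variables) is at most $(2\|\varphi\|)^{2\|\varphi\|}$.
   Context: Let $\mathsf{V}$ be an infinite set of variables and $\sigma$ a relational signature. Guards: $\alpha ::= R\bar x\mid\exists y\,\alpha$ with $R\in\sigma\cup\{=\}$. GNTC formulas: $\varphi ::= \alpha\mid\varphi\lor\varphi\mid\varphi\land\varphi\mid\exists x\,\varphi\mid\alpha\land\neg\varphi$ (with $\mathrm{FV}(\varphi)\subseteq\mathrm{FV}(\alpha)$) $\mid[\alpha\land\beta\land\varphi]^*_{\bar v\bar w}\bar x\bar y$ ($\alpha,\beta$ guards, $\bar x,\bar y,\bar v,\bar w$ of equal length $k\ge1$ — then the formula is called $k$-adic —, $\bar v\bar w$ pairwise distinct, $\mathrm{FV}(\bar v)\subseteq\mathrm{FV}(\alpha)$, $\mathrm{FV}(\bar w)\subseteq\mathrm{FV}(\beta)$, $\mathrm{FV}(\alpha\land\beta\land\varphi)\subseteq\mathrm{FV}(\bar v\bar w)$). $\|\varphi\|$ is the number of symbol occurrences; $x_1\dots x_k = y_1\dots y_k$ abbreviates $\bigwedge_i x_i=y_i$. The closure $\mathrm{cl}(\varphi)$ is a set of finite formula sets (lists; $(\Gamma,\Delta)$ denotes union, $()$ the empty set): $\mathrm{cl}(\alpha)=\{(\alpha),()\}$; $\mathrm{cl}(\varphi\lor\psi)=\{(\varphi\lor\psi)\}\cup\mathrm{cl}(\varphi)\cup\mathrm{cl}(\psi)$;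 $\mathrm{cl}(\varphi\land\psi)=\{(\varphi\land\psi)\}\cup\{(\Gamma,\Delta)\mid\Gamma\in\mathrm{cl}(\varphi),\Delta\in\mathrm{cl}(\psi),\mathrm{FV}(\Gamma)\cap\mathrm{FV}(\Delta)\subseteq\mathrm{FV}(\varphi)\cap\mathrm{FV}(\psi)\}$; $\mathrm{cl}(\exists x\,\varphi)=\{(\exists x\,\varphi)\}\cup\bigcup_{z\in\mathsf{V}\setminus\mathrm{FV}(\varphi)}\mathrm{cl}(\varphi[z/x])$; $\mathrm{cl}(\alpha\land\neg\varphi)=\{(\alpha\land\neg\varphi)\}\cup\mathrm{cl}(\varphi)$; and for a $k$-adic $[\varphi]^*_{\bar v\bar w}\bar x\bar y$ (with $\varphi$ the body): $\mathrm{cl}([\varphi]^*_{\bar v\bar w}\bar x\bar y)=\{([\varphi]^*_{\bar v\bar w}\bar x\bar y)\}\cup\bigcup_{\bar z\bar z'}(\mathrm{cl}(\bar x=\bar y)\cup\mathrm{cl}(\bar x=\bar z)\cup\mathrm{cl}(\bar z=\bar y)\cup\mathrm{cl}(\bar z=\bar z'))\cup\{(\Gamma,[\varphi]^*_{\bar v\bar w}\bar z_2\bar y),(\Gamma,[\varphi]^*_{\bar v\bar w}\bar z_2\bar z),([\varphi]^*_{\bar v\bar w}\bar x\bar z_1,\Gamma),([\varphi]^*_{\bar v\bar w}\bar z\bar z_1,\Gamma),\Gamma\}$, where the union ranges over pairwise distinct $\bar z\bar z'\in(\mathsf{V}\setminus\mathrm{FV}(\varphi))^{2k}$, and the last set ranges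 over pairwise distinct $\bar z_1\bar z_2\bar z\in(\mathsf{V}\setminus\mathrm{FV}(\varphi))^{3k}$ and $\Gamma\in\mathrm{cl}(\varphi[\bar z_1\bar z_2/\bar v\bar w])$ with $\mathrm{FV}(\Gamma)\cap\mathrm{FV}(\bar x\bar y\bar z)=\emptyset$. -}

module Defs where

open import Data.Nat using (ℕ; zero; suc; _+_; _*_; _∸_; _<_; _<ᵇ_)
open import Data.Bool using (if_then_else_)
open import Data.List using (List; []; _∷_; _++_; [_]; map; concatMap)
open import Data.Vec using (Vec; toList)
import Data.Vec as Vec
open import Data.Product using (Σ; ∃; _×_; _,_)
open import Data.Sum using (_⊎_)
open import Data.Unit using (⊤)
open import Relation.Nullary using (¬_)
open import Relation.Binary.PropositionalEquality using (_≡_)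
open import Data.List.Membership.Propositional using (_∈_; _∉_)
open import Data.List.Relation.Unary.All using (All)
open import Data.List.Relation.Unary.Unique.Propositional using (Unique)
open import Data.List.Relation.Binary.BagAndSetEquality using (_∼[_]_; set)
open import Function.Definitions using (Injective)

record Signature : Set₁ where
  field
    Rel   : Set
    arity : Rel → ℕ

-- We use a locally nameless
-- representation: free variables are names 'fr x' (x : ℕ), bound
-- variables are de Bruijn indices 'bv i'.  Formulas are thus identified
-- up to renaming of bound variables (alpha-equivalence).
data Var : Set where
  fr : ℕ → Var
  bv : ℕ → Var

module Syntax (σ : Signature) where
  open Signature σ

  -- Guards  α ::= R x̄ | x = y | ∃y α      (ex binds index 0)
  data Guard : Set where
    rel : (R : Rel) → Vec Var (arity R) → Guard
    eq  : Var → Var → Guard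
    ex  : Guard → Guard

  -- Raw formulas.
  --  gneg α φ  is  α ∧ ¬φ
  --  tc k body x̄ ȳ  is  [body]*_{v̄w̄} x̄ȳ with m = suc k variables in each
  --  tuple; the body is under 2m binders, v_i = bv i, w_i = bv (m + i)
  --  (i < m).  The shape body = α ∧ β ∧ φ is imposed by 'WF'.
  data Formula : Set where
    grd  : Guard → Formula
    or   : Formula → Formula → Formula
    and  : Formula → Formula → Formula
    ex   : Formula → Formula
    gneg : Guard → Formula → Formula
    tc   : (k : ℕ) → Formula → Vec Var (suc k) → Vec Var (suc k) → Formula

  -- Size ‖φ‖ : number of symbol occurrences (parentheses not counted).
  sizeG : Guard → ℕ
  sizeG (rel R xs) = 1 + arity R
  sizeG (eq x y)   = 3
  sizeG (ex α)     = 2 + sizeG α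

  size : Formula → ℕ
  size (grd α)          = sizeG α
  size (or φ ψ)         = 1 + size φ + size ψ
  size (and φ ψ)        = 1 + size φ + size ψ
  size (ex φ)           = 2 + size φ
  size (gneg α φ)       = 2 + sizeG α + size φ
  size (tc k b xs ys)   = 3 + 4 * suc k + size b   -- '[' ']' '*', v̄w̄x̄ȳ, body

  -- Free names (the free variables of a locally closed formula).
  fvV : Var → List ℕ
  fvV (fr x) = [ x ]
  fvV (bv _) = []

  fvVs : ∀ {n} → Vec Var n → List ℕ
  fvVs xs = concatMap fvV (toList xs)

  fvG : Guard → List ℕ
  fvG (rel R xs) = fvVs xs
  fvG (eq x y)   = fvV x ++ fvV y
  fvG (ex α)     = fvG α

  fv : Formula → List ℕ
  fv (grd α)        = fvG α
  fv (or φ ψ)       = fv φ ++ fv ψ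
  fv (and φ ψ)      = fv φ ++ fv ψ
  fv (ex φ)         = fv φ
  fv (gneg α φ)     = fvG α ++ fv φ
  fv (tc k b xs ys) = fv b ++ fvVs xs ++ fvVs ys

  fvL : List Formula → List ℕ
  fvL = concatMap fv

  -- Free variables of a subformula, including dangling bound indices
  -- (normalised relative to the subformula); used for side conditions.
  dV : ℕ → Var → List Var
  dV d (fr x) = [ fr x ]
  dV d (bv j) = if j <ᵇ d then [] else [ bv (j ∸ d) ]

  dVs : ∀ {n} → ℕ → Vec Var n → List Var
  dVs d xs = concatMap (dV d) (toList xs)

  dG : ℕ → Guard → List Var
  dG d (rel R xs) = dVs d xs
  dG d (eq x y)   = dV d x ++ dV d y
  dG d (ex α)     = dG (suc d) α

  dF : ℕ → Formula → List Var
  dF d (grd α)        = dG d α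
  dF d (or φ ψ)       = dF d φ ++ dF d ψ
  dF d (and φ ψ)      = dF d φ ++ dF d ψ
  dF d (ex φ)         = dF (suc d) φ
  dF d (gneg α φ)     = dG d α ++ dF d φ
  dF d (tc k b xs ys) = dF (d + 2 * suc k) b ++ dVs d xs ++ dVs d ys

  -- the body of a transitive closure has the shape α ∧ β ∧ φ
  -- (either bracketing) with FV(v̄) ⊆ FV(α), FV(w̄) ⊆ FV(β)
  data TCBody (m : ℕ) : Formula → Set where
    bodyʳ : ∀ {α β φ} →
            (∀ i → i < m → bv i ∈ dG 0 α) →
            (∀ i → i < m → bv (m + i) ∈ dG 0 β) →
            TCBody m (and (grd α) (and (grd β) φ))
    bodyˡ : ∀ {α β φ} →
            (∀ i → i < m → bv i ∈ dG 0 α) →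
            (∀ i → i < m → bv (m + i) ∈ dG 0 β) →
            TCBody m (and (and (grd α) (grd β)) φ)

  WF : Formula → Set
  WF (grd α)        = ⊤
  WF (or φ ψ)       = WF φ × WF ψ
  WF (and φ ψ)      = WF φ × WF ψ
  WF (ex φ)         = WF φ
  WF (gneg α φ)     = WF φ × (∀ v → v ∈ dF 0 φ → v ∈ dG 0 α)
  WF (tc k b xs ys) = WF b × TCBody (suc k) b
                      × (∀ v → v ∈ dF 0 b → ∃ λ i → i < 2 * suc k × v ≡ bv i)

  LC : Formula → Set
  LC φ = ∀ v → v ∈ dF 0 φ → ∃ λ x → v ≡ fr x

  GNTC : Formula → Set
  GNTC φ = WF φ × LC φ

  -- Instantiation of bound variables by names: openF d zs φ replaces
  -- bv (d + i) by fr (zs ! i) for i < length zs (and lowers the others).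
  inst : List ℕ → ℕ → Var
  inst []       i       = bv i
  inst (z ∷ zs) zero    = fr z
  inst (z ∷ zs) (suc i) = inst zs i

  shift : ℕ → Var → Var
  shift d (fr x) = fr x
  shift d (bv i) = bv (d + i)

  openV : ℕ → List ℕ → Var → Var
  openV d zs (fr x) = fr x
  openV d zs (bv j) = if j <ᵇ d then bv j else shift d (inst zs (j ∸ d))

  openG : ℕ → List ℕ → Guard → Guard
  openG d zs (rel R xs) = rel R (Vec.map (openV d zs) xs)
  openG d zs (eq x y)   = eq (openV d zs x) (openV d zs y)
  openG d zs (ex α)     = ex (openG (suc d) zs α)

  openF : ℕ → List ℕ → Formula → Formula
  openF d zs (grd α)        = grd (openG d zs α)
  openF d zs (or φ ψ)       = or (openF d zs φ) (openF d zs ψ)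
  openF d zs (and φ ψ)      = and (openF d zs φ) (openF d zs ψ)
  openF d zs (ex φ)         = ex (openF (suc d) zs φ)
  openF d zs (gneg α φ)     = gneg (openG d zs α) (openF d zs φ)
  openF d zs (tc k b xs ys) = tc k (openF (d + 2 * suc k) zs b)
                                   (Vec.map (openV d zs) xs) (Vec.map (openV d zs) ys)

  renV : (ℕ → ℕ) → Var → Var
  renV ρ (fr x) = fr (ρ x)
  renV ρ (bv i) = bv i

  renG : (ℕ → ℕ) → Guard → Guard
  renG ρ (rel R xs) = rel R (Vec.map (renV ρ) xs)
  renG ρ (eq x y)   = eq (renV ρ x) (renV ρ y)
  renG ρ (ex α)     = ex (renG ρ α)

  ren : (ℕ → ℕ) → Formula → Formula
  ren ρ (grd α)        = grd (renG ρ α)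
  ren ρ (or φ ψ)       = or (ren ρ φ) (ren ρ ψ)
  ren ρ (and φ ψ)      = and (ren ρ φ) (ren ρ ψ)
  ren ρ (ex φ)         = ex (ren ρ φ)
  ren ρ (gneg α φ)     = gneg (renG ρ α) (ren ρ φ)
  ren ρ (tc k b xs ys) = tc k (ren ρ b) (Vec.map (renV ρ) xs) (Vec.map (renV ρ) ys)

  _≈ren_ : List Formula → List Formula → Set
  Γ ≈ren Δ = Σ (ℕ → ℕ) λ ρ → Injective _≡_ _≡_ ρ × (map (ren ρ) Γ ∼[ set ] Δ)

  -- x̄ = ȳ  abbreviates  ⋀ᵢ xᵢ = yᵢ  (right-nested)
  eqs : ∀ {k} → Vec Var (suc k) → Vec Var (suc k) → Formula
  eqs {zero}  (x Vec.∷ Vec.[]) (y Vec.∷ Vec.[]) = grd (eq x y)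
  eqs {suc k} (x Vec.∷ xs)     (y Vec.∷ ys)     = and (grd (eq x y)) (eqs xs ys)

  names : ∀ {n} → Vec ℕ n → Vec Var n
  names = Vec.map fr

  data TCStep {m : ℕ} (T : Vec Var m → Vec Var m → Formula)
              (xs ys : Vec Var m) (z₁ z₂ z : Vec ℕ m) (Γ : List Formula)
              : List Formula → Set where
    step₁ : TCStep T xs ys z₁ z₂ z Γ (Γ ++ [ T (names z₂) ys ])
    step₂ : TCStep T xs ys z₁ z₂ z Γ (Γ ++ [ T (names z₂) (names z) ])
    step₃ : TCStep T xs ys z₁ z₂ z Γ ([ T xs (names z₁) ] ++ Γ)
    step₄ : TCStep T xs ys z₁ z₂ z Γ ([ T (names z) (names z₁) ] ++ Γ)
    step₅ : TCStep T xs ys z₁ z₂ z Γ Γ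

  -- The closure:  Cl φ Γ  means  Γ ∈ cl(φ)  (Γ a list read as a set).
  data Cl : Formula → List Formula → Set where
    grd-self  : ∀ {α} → Cl (grd α) [ grd α ]
    grd-empty : ∀ {α} → Cl (grd α) []
    or-self   : ∀ {φ ψ} → Cl (or φ ψ) [ or φ ψ ]
    or-l      : ∀ {φ ψ Γ} → Cl φ Γ → Cl (or φ ψ) Γ
    or-r      : ∀ {φ ψ Γ} → Cl ψ Γ → Cl (or φ ψ) Γ
    and-self  : ∀ {φ ψ} → Cl (and φ ψ) [ and φ ψ ]
    and-split : ∀ {φ ψ Γ Δ} → Cl φ Γ → Cl ψ Δ →
                (∀ x → x ∈ fvL Γ → x ∈ fvL Δ → x ∈ fv φ × x ∈ fv ψ) →
                Cl (and φ ψ) (Γ ++ Δ)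
    ex-self   : ∀ {φ} → Cl (ex φ) [ ex φ ]
    ex-inst   : ∀ {φ Γ} (z : ℕ) → z ∉ fv φ → Cl (openF 0 [ z ] φ) Γ → Cl (ex φ) Γ
    gneg-self : ∀ {α φ} → Cl (gneg α φ) [ gneg α φ ]
    gneg-sub  : ∀ {α φ Γ} → Cl φ Γ → Cl (gneg α φ) Γ
    tc-self   : ∀ {k b xs ys} → Cl (tc k b xs ys) [ tc k b xs ys ]
    tc-xy     : ∀ {k b xs ys Γ} → Cl (eqs xs ys) Γ → Cl (tc k b xs ys) Γ
    tc-xz     : ∀ {k b xs ys Γ} (z z′ : Vec ℕ (suc k)) →
                Unique (toList z ++ toList z′) → All (_∉ fv b) (toList z ++ toList z′) →
                Cl (eqs xs (names z)) Γ → Cl (tc k b xs ys) Γ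
    tc-zy     : ∀ {k b xs ys Γ} (z z′ : Vec ℕ (suc k)) →
                Unique (toList z ++ toList z′) → All (_∉ fv b) (toList z ++ toList z′) →
                Cl (eqs (names z) ys) Γ → Cl (tc k b xs ys) Γ
    tc-zz     : ∀ {k b xs ys Γ} (z z′ : Vec ℕ (suc k)) →
                Unique (toList z ++ toList z′) → All (_∉ fv b) (toList z ++ toList z′) →
                Cl (eqs (names z) (names z′)) Γ → Cl (tc k b xs ys) Γ
    tc-step   : ∀ {k b xs ys Γ Δ} (z₁ z₂ z : Vec ℕ (suc k)) →
                Unique (toList z₁ ++ toList z₂ ++ toList z) →
                All (_∉ fv b) (toList z₁ ++ toList z₂ ++ toList z) →
                Cl (openF 0 (toList z₁ ++ toList z₂) b) Γ →
                (∀ x → x ∈ fvL Γ → x ∉ fvVs xs ++ fvVs ys ++ toList z) →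
                TCStep (tc k b) xs ys z₁ z₂ z Γ Δ →
                Cl (tc k b xs ys) Δ

{-# OPTIONS --safe #-}
module Submission where

-- Erasing every free name (renaming all of them to 0) maps cl(φ) into an explicitly enumerated
-- list of at most 2^‖φ‖ skeletons.  By well-formedness the bodies of transitive closures contain
-- no free names, so a skeleton has at most ‖φ‖ occurrences of free names.  Renaming each name of
-- Γ ∈ cl(φ) to the position of its first occurrence in Γ is injective, and turns Γ into its
-- skeleton refilled with a word of length at most ‖φ‖ over {0, …, ‖φ‖ - 1}.  Hence, with n = ‖φ‖,
-- at most 2^n · n^n ≤ (2n)^(2n) sets represent cl(φ) up to renaming.

open import Defs
open import Data.Bool using (true; false)
open import Data.List
  using (List; []; _∷_; _++_; [_]; map; length; concatMap; cartesianProductWith; upTo)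
open import Data.List.Properties
  using (length-++; length-map; map-++; ++-assoc; ++-identityʳ; concatMap-++; length-upTo)
open import Data.List.Membership.Propositional using (_∈_)
open import Data.List.Membership.Propositional.Properties
  using (∈-++⁺ˡ; ∈-++⁺ʳ; ∈-map⁺; ∈-concatMap⁺; ∈-cartesianProductWith⁺; ∈-upTo⁺)
open import Data.List.Relation.Unary.All as All using (All; []; _∷_)
import Data.List.Relation.Unary.All.Properties as All
open import Data.List.Relation.Unary.Any as Any using (Any; here; there)
open import Data.Nat
  using (ℕ; zero; suc; _+_; _*_; _∸_; _^_; _≤_; _<_; _<ᵇ_; z≤n; s≤s; NonZero; >-nonZero; _≟_)
open import Data.Nat.Properties
open import Data.Nat.Tactic.RingSolver using (solve-∀)
open import Data.Product using (Σ; ∃; _×_; _,_; proj₁; uncurry)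
import Data.Product as Product
open import Data.Unit using (⊤; tt)
open import Data.Vec using (Vec; toList)
import Data.Vec as Vec
import Data.Vec.Properties as VecP
open import Data.Vec.Relation.Unary.All as VAll using ()
open import Function using (const; _∘_)
open import Function.Definitions using (Injective)
open import Function.Related.Propositional using (K-refl)
open import Relation.Nullary using (yes; no; contradiction)
open import Relation.Nullary.Reflects using (ofʸ; ofⁿ)
open import Relation.Binary.PropositionalEquality
  using (_≡_; refl; sym; trans; cong; cong₂; subst; setoid; module ≡-Reasoning)

length-++-≤ : ∀ {A : Set} (xs ys : List A) {a b} →
              length xs ≤ a → length ys ≤ b → length (xs ++ ys) ≤ a + b
length-++-≤ xs ys p q = ≤-trans (≤-reflexive (length-++ xs)) (+-mono-≤ p q)

length-concatMap-≤ : ∀ {A B : Set} (f : A → List B) {c} {xs : List A} →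
                     All (λ x → length (f x) ≤ c) xs → length (concatMap f xs) ≤ length xs * c
length-concatMap-≤ f []                       = z≤n
length-concatMap-≤ f {xs = x ∷ _} (fx≤c ∷ fxs≤c) =
  length-++-≤ (f x) _ fx≤c (length-concatMap-≤ f fxs≤c)

length-cartesianProductWith : ∀ {A B C : Set} (f : A → B → C) (xs : List A) (ys : List B) →
                              length (cartesianProductWith f xs ys) ≡ length xs * length ys
length-cartesianProductWith f []       ys = refl
length-cartesianProductWith f (x ∷ xs) ys = begin
  length (map (f x) ys ++ cartesianProductWith f xs ys)         ≡⟨ length-++ (map (f x) ys) ⟩
  length (map (f x) ys) + length (cartesianProductWith f xs ys)
    ≡⟨ cong₂ _+_ (length-map (f x) ys) (length-cartesianProductWith f xs ys) ⟩
  length ys + length xs * length ys                             ∎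
  where open ≡-Reasoning

concatMap-map-commute : ∀ {A A′ B B′ : Set} {f : A → List B} {g : A′ → List B′}
                        {h : A → A′} {ρ : B → B′} → (∀ x → g (h x) ≡ map ρ (f x)) →
                        ∀ xs → concatMap g (map h xs) ≡ map ρ (concatMap f xs)
concatMap-map-commute         comm []       = refl
concatMap-map-commute {f = f} {g} {h} {ρ} comm (x ∷ xs) = begin
  g (h x) ++ concatMap g (map h xs)     ≡⟨ cong₂ _++_ (comm x) (concatMap-map-commute comm xs) ⟩
  map ρ (f x) ++ map ρ (concatMap f xs) ≡⟨ map-++ ρ (f x) _ ⟨
  map ρ (f x ++ concatMap f xs)         ∎
  where open ≡-Reasoning

map-commute : ∀ {A B C D : Set} {f : B → D} {g : A → B} {g′ : C → D} {f′ : A → C} →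
              (∀ x → f (g x) ≡ g′ (f′ x)) → ∀ {n} (xs : Vec A n) →
              Vec.map f (Vec.map g xs) ≡ Vec.map g′ (Vec.map f′ xs)
map-commute comm Vec.[]       = refl
map-commute comm (x Vec.∷ xs) = cong₂ Vec._∷_ (comm x) (map-commute comm xs)

map-fixes : ∀ {A : Set} {P : A → Set} {f : A → A} {n} {xs : Vec A n} →
            (∀ {x} → P x → f x ≡ x) → VAll.All P xs → Vec.map f xs ≡ xs
map-fixes fix VAll.[]         = refl
map-fixes fix (px VAll.∷ pxs) = cong₂ Vec._∷_ (fix px) (map-fixes fix pxs)

-- Off O, position O x = length O + x, which makes position O injective on all of ℕ.
position : List ℕ → ℕ → ℕ
position []       x = x
position (o ∷ os) x with x ≟ o
... | yes _ = 0
... | no  _ = suc (position os x)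

position-injective : ∀ O → Injective _≡_ _≡_ (position O)
position-injective []       eq = eq
position-injective (o ∷ os) {x} {y} eq with x ≟ o | y ≟ o
... | yes x≡o | yes y≡o = trans x≡o (sym y≡o)
... | yes _   | no  _   = contradiction eq λ ()
... | no  _   | yes _   = contradiction eq λ ()
... | no  _   | no  _   = position-injective os (suc-injective eq)

position-< : ∀ {O x} → x ∈ O → position O x < length O
position-< {o ∷ os} {x} x∈O with x ≟ o
position-< _            | yes _   = s≤s z≤n
position-< (here x≡o)   | no  x≢o = contradiction x≡o x≢o
position-< (there x∈os) | no  _   = s≤s (position-< x∈os)

words : ℕ → ℕ → List (List ℕ)
words zero    n = [ [] ]
words (suc L) n = cartesianProductWith _∷_ (upTo n) (words L n)

length-words : ∀ L n → length (words L n) ≡ n ^ L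
length-words zero    n = refl
length-words (suc L) n = trans (length-cartesianProductWith _∷_ (upTo n) (words L n))
                               (cong₂ _*_ (length-upTo n) (length-words L n))

∈-words : ∀ {n} ws → All (_< n) ws → ws ∈ words (length ws) n
∈-words []       []            = here refl
∈-words (w ∷ ws) (w<n ∷ ws<n) =
  ∈-cartesianProductWith⁺ _∷_ (∈-upTo⁺ w<n) (∈-words ws ws<n)

m≤2^n⇒1+m≤2^[1+n] : ∀ {m} n → m ≤ 2 ^ n → suc m ≤ 2 ^ suc n
m≤2^n⇒1+m≤2^[1+n] {m} n m≤2ⁿ = begin
  suc m           ≤⟨ s≤s m≤2ⁿ ⟩
  1 + 2 ^ n       ≤⟨ +-monoˡ-≤ (2 ^ n) (m^n>0 2 n) ⟩
  2 ^ n + 2 ^ n   ≡⟨ cong (2 ^ n +_) (+-identityʳ (2 ^ n)) ⟨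
  2 ^ suc n       ∎
  where open ≤-Reasoning

m+n≤m*n : ∀ {m n} → 2 ≤ m → 2 ≤ n → m + n ≤ m * n
m+n≤m*n {suc (suc m)} {suc (suc n)} (s≤s (s≤s _)) (s≤s (s≤s _)) =
  ≤-trans (m≤m+n (2 + m + (2 + n)) _) (≤-reflexive (sym (expand m n)))
  where
  expand : ∀ m n → (2 + m) * (2 + n) ≡ (2 + m + (2 + n)) + (m + n + m * n)
  expand = solve-∀

1+4m+5n≤8mn : ∀ {m n} → 2 ≤ m → 2 ≤ n → suc (4 * m + n * 5) ≤ 2 * (2 * (2 * m)) * n
1+4m+5n≤8mn {suc (suc m)} {suc (suc n)} (s≤s (s≤s _)) (s≤s (s≤s _)) =
  ≤-trans (m≤m+n (suc (4 * (2 + m) + (2 + n) * 5)) _) (≤-reflexive (sym (expand m n)))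
  where
  expand : ∀ m n → 2 * (2 * (2 * (2 + m))) * (2 + n)
                 ≡ suc (4 * (2 + m) + (2 + n) * 5) + (13 + 12 * m + 11 * n + 8 * (m * n))
  expand = solve-∀

2ⁿ*nⁿ≤[2n]^[2n] : ∀ n .{{_ : NonZero n}} → 2 ^ n * n ^ n ≤ (2 * n) ^ (2 * n)
2ⁿ*nⁿ≤[2n]^[2n] n = begin
  2 ^ n * n ^ n
    ≤⟨ *-mono-≤ (^-monoˡ-≤ n (m≤m*n 2 n)) (^-monoˡ-≤ n (m≤n*m n 2)) ⟩
  (2 * n) ^ n * (2 * n) ^ n ≡⟨ ^-distribˡ-+-* (2 * n) n n ⟨
  (2 * n) ^ (n + n)         ≡⟨ cong (λ m → (2 * n) ^ (n + m)) (+-identityʳ n) ⟨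
  (2 * n) ^ (2 * n)         ∎
  where open ≤-Reasoning

m<n⇒n<1+o⇒m<o : ∀ {m n o} → m < n → n < suc o → m < o
m<n⇒n<1+o⇒m<o m<n n<1+o = <-≤-trans m<n (≤-pred n<1+o)

module GNTCClosure (σ : Signature) where
  open Syntax σ

  sizeG-openG : ∀ d zs α → sizeG (openG d zs α) ≡ sizeG α
  sizeG-openG d zs (rel R xs) = refl
  sizeG-openG d zs (eq x y)   = refl
  sizeG-openG d zs (ex α)     = cong (2 +_) (sizeG-openG (suc d) zs α)

  size-openF : ∀ d zs φ → size (openF d zs φ) ≡ size φ
  size-openF d zs (grd α)        = sizeG-openG d zs α
  size-openF d zs (or φ ψ)       = cong₂ (λ a b → 1 + a + b) (size-openF d zs φ) (size-openF d zs ψ)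
  size-openF d zs (and φ ψ)      = cong₂ (λ a b → 1 + a + b) (size-openF d zs φ) (size-openF d zs ψ)
  size-openF d zs (ex φ)         = cong (2 +_) (size-openF (suc d) zs φ)
  size-openF d zs (gneg α φ)     = cong₂ (λ a b → 2 + a + b) (sizeG-openG d zs α) (size-openF d zs φ)
  size-openF d zs (tc k b xs ys) = cong (3 + 4 * suc k +_) (size-openF (d + 2 * suc k) zs b)

  sizeG-renG : ∀ ρ α → sizeG (renG ρ α) ≡ sizeG α
  sizeG-renG ρ (rel R xs) = refl
  sizeG-renG ρ (eq x y)   = refl
  sizeG-renG ρ (ex α)     = cong (2 +_) (sizeG-renG ρ α)

  size-ren : ∀ ρ φ → size (ren ρ φ) ≡ size φ
  size-ren ρ (grd α)        = sizeG-renG ρ α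
  size-ren ρ (or φ ψ)       = cong₂ (λ a b → 1 + a + b) (size-ren ρ φ) (size-ren ρ ψ)
  size-ren ρ (and φ ψ)      = cong₂ (λ a b → 1 + a + b) (size-ren ρ φ) (size-ren ρ ψ)
  size-ren ρ (ex φ)         = cong (2 +_) (size-ren ρ φ)
  size-ren ρ (gneg α φ)     = cong₂ (λ a b → 2 + a + b) (sizeG-renG ρ α) (size-ren ρ φ)
  size-ren ρ (tc k b xs ys) = cong (3 + 4 * suc k +_) (size-ren ρ b)

  sizeG>0 : ∀ α → 0 < sizeG α
  sizeG>0 (rel R xs) = s≤s z≤n
  sizeG>0 (eq x y)   = s≤s z≤n
  sizeG>0 (ex α)     = s≤s z≤n

  size>0 : ∀ φ → 0 < size φ
  size>0 (grd α)        = sizeG>0 α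
  size>0 (or φ ψ)       = s≤s z≤n
  size>0 (and φ ψ)      = s≤s z≤n
  size>0 (ex φ)         = s≤s z≤n
  size>0 (gneg α φ)     = s≤s z≤n
  size>0 (tc k b xs ys) = s≤s z≤n

  size-eqs : ∀ {k} (us vs : Vec Var (suc k)) → size (eqs us vs) ≤ 4 * suc k
  size-eqs {zero}  (u Vec.∷ Vec.[]) (v Vec.∷ Vec.[]) = s≤s (s≤s (s≤s z≤n))
  size-eqs {suc k} (u Vec.∷ us)     (v Vec.∷ vs)     =
    ≤-trans (+-monoʳ-≤ 4 (size-eqs us vs)) (≤-reflexive (sym (*-suc 4 (suc k))))

  size-<-orˡ : ∀ φ ψ → size φ < size (or φ ψ)
  size-<-orˡ φ ψ = s≤s (m≤m+n (size φ) (size ψ))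

  size-<-orʳ : ∀ φ ψ → size ψ < size (or φ ψ)
  size-<-orʳ φ ψ = s≤s (m≤n+m (size ψ) (size φ))

  size-<-andˡ : ∀ φ ψ → size φ < size (and φ ψ)
  size-<-andˡ = size-<-orˡ

  size-<-andʳ : ∀ φ ψ → size ψ < size (and φ ψ)
  size-<-andʳ = size-<-orʳ

  size-<-ex : ∀ zs φ → size (openF 0 zs φ) < size (ex φ)
  size-<-ex zs φ = s≤s (m≤n⇒m≤1+n (≤-reflexive (size-openF 0 zs φ)))

  size-<-gneg : ∀ α φ → size φ < size (gneg α φ)
  size-<-gneg α φ = s≤s (m≤n⇒m≤1+n (m≤n+m (size φ) (sizeG α)))

  module _ {k} (b : Formula) (xs ys : Vec Var (suc k)) where

    size-<-tc-eqs : ∀ us vs → size (eqs us vs) < size (tc k b xs ys)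
    size-<-tc-eqs us vs = s≤s (≤-trans (size-eqs us vs) (≤-trans (m≤m+n _ (size b)) (m≤n+m _ 2)))

    size-<-tc-body : ∀ zs → size (openF 0 zs b) < size (tc k b xs ys)
    size-<-tc-body zs =
      subst (_< size (tc k b xs ys)) (sym (size-openF 0 zs b)) (s≤s (m≤n+m (size b) (2 + 4 * suc k)))

    size-body+2m-≤-tc : size b + (suc k + suc k) ≤ size (tc k b xs ys)
    size-body+2m-≤-tc =
      ≤-trans (m≤m+n _ (3 + suc k + suc k)) (≤-reflexive (sym (rearrange (size b) (suc k))))
      where
      rearrange : ∀ s m → 3 + 4 * m + s ≡ (s + (m + m)) + (3 + m + m)
      rearrange = solve-∀

  renV-inst : ∀ ρ d zs i → renV ρ (shift d (inst zs i)) ≡ shift d (inst (map ρ zs) i)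
  renV-inst ρ d []       i       = refl
  renV-inst ρ d (z ∷ zs) zero    = refl
  renV-inst ρ d (z ∷ zs) (suc i) = renV-inst ρ d zs i

  renV-openV : ∀ ρ d zs v → renV ρ (openV d zs v) ≡ openV d (map ρ zs) (renV ρ v)
  renV-openV ρ d zs (fr x) = refl
  renV-openV ρ d zs (bv j) with j <ᵇ d
  ... | true  = refl
  ... | false = renV-inst ρ d zs (j ∸ d)

  renG-openG : ∀ ρ d zs α → renG ρ (openG d zs α) ≡ openG d (map ρ zs) (renG ρ α)
  renG-openG ρ d zs (rel R xs) = cong (rel R) (map-commute (renV-openV ρ d zs) xs)
  renG-openG ρ d zs (eq x y)   = cong₂ eq (renV-openV ρ d zs x) (renV-openV ρ d zs y)
  renG-openG ρ d zs (ex α)     = cong ex (renG-openG ρ (suc d) zs α)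

  ren-openF : ∀ ρ d zs φ → ren ρ (openF d zs φ) ≡ openF d (map ρ zs) (ren ρ φ)
  ren-openF ρ d zs (grd α)        = cong grd (renG-openG ρ d zs α)
  ren-openF ρ d zs (or φ ψ)       = cong₂ or (ren-openF ρ d zs φ) (ren-openF ρ d zs ψ)
  ren-openF ρ d zs (and φ ψ)      = cong₂ and (ren-openF ρ d zs φ) (ren-openF ρ d zs ψ)
  ren-openF ρ d zs (ex φ)         = cong ex (ren-openF ρ (suc d) zs φ)
  ren-openF ρ d zs (gneg α φ)     = cong₂ gneg (renG-openG ρ d zs α) (ren-openF ρ d zs φ)
  ren-openF ρ d zs (tc k b xs ys) =
    trans (cong (λ b′ → tc k b′ _ _) (ren-openF ρ (d + 2 * suc k) zs b))
          (cong₂ (tc k _) (map-commute (renV-openV ρ d zs) xs) (map-commute (renV-openV ρ d zs) ys))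

  ren-eqs : ∀ {k} ρ (us vs : Vec Var (suc k)) →
            ren ρ (eqs us vs) ≡ eqs (Vec.map (renV ρ) us) (Vec.map (renV ρ) vs)
  ren-eqs {zero}  ρ (u Vec.∷ Vec.[]) (v Vec.∷ Vec.[]) = refl
  ren-eqs {suc k} ρ (u Vec.∷ us)     (v Vec.∷ vs)     = cong (and _) (ren-eqs ρ us vs)

  fvV-renV : ∀ ρ v → fvV (renV ρ v) ≡ map ρ (fvV v)
  fvV-renV ρ (fr x) = refl
  fvV-renV ρ (bv i) = refl

  fvVs-renV : ∀ {n} ρ (xs : Vec Var n) → fvVs (Vec.map (renV ρ) xs) ≡ map ρ (fvVs xs)
  fvVs-renV ρ xs = trans (cong (concatMap fvV) (VecP.toList-map (renV ρ) xs))
                         (concatMap-map-commute (fvV-renV ρ) (toList xs))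

  fvG-renG : ∀ ρ α → fvG (renG ρ α) ≡ map ρ (fvG α)
  fvG-renG ρ (rel R xs) = fvVs-renV ρ xs
  fvG-renG ρ (eq x y)   = trans (cong₂ _++_ (fvV-renV ρ x) (fvV-renV ρ y)) (sym (map-++ ρ (fvV x) _))
  fvG-renG ρ (ex α)     = fvG-renG ρ α

  fv-ren : ∀ ρ φ → fv (ren ρ φ) ≡ map ρ (fv φ)
  fv-ren ρ (grd α)        = fvG-renG ρ α
  fv-ren ρ (or φ ψ)       = trans (cong₂ _++_ (fv-ren ρ φ) (fv-ren ρ ψ)) (sym (map-++ ρ (fv φ) _))
  fv-ren ρ (and φ ψ)      = trans (cong₂ _++_ (fv-ren ρ φ) (fv-ren ρ ψ)) (sym (map-++ ρ (fv φ) _))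
  fv-ren ρ (ex φ)         = fv-ren ρ φ
  fv-ren ρ (gneg α φ)     =
    trans (cong₂ _++_ (fvG-renG ρ α) (fv-ren ρ φ)) (sym (map-++ ρ (fvG α) _))
  fv-ren ρ (tc k b xs ys) = begin
    fv (ren ρ b) ++ fvVs (Vec.map (renV ρ) xs) ++ fvVs (Vec.map (renV ρ) ys)
      ≡⟨ cong₂ _++_ (fv-ren ρ b) (cong₂ _++_ (fvVs-renV ρ xs) (fvVs-renV ρ ys)) ⟩
    map ρ (fv b) ++ map ρ (fvVs xs) ++ map ρ (fvVs ys)
      ≡⟨ cong (map ρ (fv b) ++_) (map-++ ρ (fvVs xs) _) ⟨
    map ρ (fv b) ++ map ρ (fvVs xs ++ fvVs ys)
      ≡⟨ map-++ ρ (fv b) _ ⟨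
    map ρ (fv b ++ fvVs xs ++ fvVs ys) ∎
    where open ≡-Reasoning

  fvL-ren : ∀ ρ Γ → fvL (map (ren ρ) Γ) ≡ map ρ (fvL Γ)
  fvL-ren ρ = concatMap-map-commute (fv-ren ρ)

  length-fvV : ∀ v → length (fvV v) ≤ 1
  length-fvV (fr x) = ≤-refl
  length-fvV (bv i) = z≤n

  length-fvVs : ∀ {n} (xs : Vec Var n) → length (fvVs xs) ≤ n
  length-fvVs Vec.[]       = z≤n
  length-fvVs (x Vec.∷ xs) = length-++-≤ (fvV x) _ (length-fvV x) (length-fvVs xs)

  length-fvG : ∀ α → length (fvG α) ≤ sizeG α
  length-fvG (rel R xs) = m≤n⇒m≤1+n (length-fvVs xs)
  length-fvG (eq x y)   = m≤n⇒m≤1+n (length-++-≤ (fvV x) _ (length-fvV x) (length-fvV y))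
  length-fvG (ex α)     = m≤n⇒m≤o+n 2 (length-fvG α)

  length-fv : ∀ φ → length (fv φ) ≤ size φ
  length-fv (grd α)        = length-fvG α
  length-fv (or φ ψ)       = m≤n⇒m≤1+n (length-++-≤ (fv φ) _ (length-fv φ) (length-fv ψ))
  length-fv (and φ ψ)      = m≤n⇒m≤1+n (length-++-≤ (fv φ) _ (length-fv φ) (length-fv ψ))
  length-fv (ex φ)         = m≤n⇒m≤o+n 2 (length-fv φ)
  length-fv (gneg α φ)     = m≤n⇒m≤o+n 2 (length-++-≤ (fvG α) _ (length-fvG α) (length-fv φ))
  length-fv (tc k b xs ys) = ≤-trans (length-++-≤ (fv b) _ (length-fv b)
                                        (length-++-≤ (fvVs xs) _ (length-fvVs xs) (length-fvVs ys)))
                                     (size-body+2m-≤-tc b xs ys)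

  -- Closed transitive-closure bodies

  data BoundBelow (n : ℕ) : Var → Set where
    bv< : ∀ {j} → j < n → BoundBelow n (bv j)

  ClosedG : ℕ → Guard → Set
  ClosedG n (rel R xs) = VAll.All (BoundBelow n) xs
  ClosedG n (eq x y)   = BoundBelow n x × BoundBelow n y
  ClosedG n (ex α)     = ClosedG (suc n) α

  Closed : ℕ → Formula → Set
  Closed n (grd α)        = ClosedG n α
  Closed n (or φ ψ)       = Closed n φ × Closed n ψ
  Closed n (and φ ψ)      = Closed n φ × Closed n ψ
  Closed n (ex φ)         = Closed (suc n) φ
  Closed n (gneg α φ)     = ClosedG n α × Closed n φ
  Closed n (tc k b xs ys) =
    Closed (n + 2 * suc k) b × VAll.All (BoundBelow n) xs × VAll.All (BoundBelow n) ys

  openV-bound : ∀ {n d} zs {v} → BoundBelow n v → n ≤ d → openV d zs v ≡ v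
  openV-bound {d = d} zs (bv< {j} j<n) n≤d with j <ᵇ d | <ᵇ-reflects-< j d
  ... | true  | _       = refl
  ... | false | ofⁿ j≮d = contradiction (<-≤-trans j<n n≤d) j≮d

  openG-closed : ∀ {n d} zs α → ClosedG n α → n ≤ d → openG d zs α ≡ α
  openG-closed zs (rel R xs) bxs       n≤d =
    cong (rel R) (map-fixes (λ b → openV-bound zs b n≤d) bxs)
  openG-closed zs (eq x y)   (bx , by) n≤d =
    cong₂ eq (openV-bound zs bx n≤d) (openV-bound zs by n≤d)
  openG-closed zs (ex α)     cα        n≤d = cong ex (openG-closed zs α cα (s≤s n≤d))

  openF-closed : ∀ {n d} zs φ → Closed n φ → n ≤ d → openF d zs φ ≡ φ
  openF-closed zs (grd α)    cα        n≤d = cong grd (openG-closed zs α cα n≤d)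
  openF-closed zs (or φ ψ)   (cφ , cψ) n≤d =
    cong₂ or (openF-closed zs φ cφ n≤d) (openF-closed zs ψ cψ n≤d)
  openF-closed zs (and φ ψ)  (cφ , cψ) n≤d =
    cong₂ and (openF-closed zs φ cφ n≤d) (openF-closed zs ψ cψ n≤d)
  openF-closed zs (ex φ)     cφ        n≤d = cong ex (openF-closed zs φ cφ (s≤s n≤d))
  openF-closed zs (gneg α φ) (cα , cφ) n≤d =
    cong₂ gneg (openG-closed zs α cα n≤d) (openF-closed zs φ cφ n≤d)
  openF-closed zs (tc k b xs ys) (cb , bxs , bys) n≤d =
    trans (cong (λ b′ → tc k b′ _ _) (openF-closed zs b cb (+-monoˡ-≤ (2 * suc k) n≤d)))
          (cong₂ (tc k b) (map-fixes (λ b → openV-bound zs b n≤d) bxs)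
                          (map-fixes (λ b → openV-bound zs b n≤d) bys))

  renV-bound : ∀ ρ {n v} → BoundBelow n v → renV ρ v ≡ v
  renV-bound ρ (bv< _) = refl

  renG-closed : ∀ ρ {n} α → ClosedG n α → renG ρ α ≡ α
  renG-closed ρ (rel R xs) bxs       = cong (rel R) (map-fixes (renV-bound ρ) bxs)
  renG-closed ρ (eq x y)   (bx , by) = cong₂ eq (renV-bound ρ bx) (renV-bound ρ by)
  renG-closed ρ (ex α)     cα        = cong ex (renG-closed ρ α cα)

  ren-closed : ∀ ρ {n} φ → Closed n φ → ren ρ φ ≡ φ
  ren-closed ρ (grd α)        cα        = cong grd (renG-closed ρ α cα)
  ren-closed ρ (or φ ψ)       (cφ , cψ) = cong₂ or (ren-closed ρ φ cφ) (ren-closed ρ ψ cψ)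
  ren-closed ρ (and φ ψ)      (cφ , cψ) = cong₂ and (ren-closed ρ φ cφ) (ren-closed ρ ψ cψ)
  ren-closed ρ (ex φ)         cφ        = cong ex (ren-closed ρ φ cφ)
  ren-closed ρ (gneg α φ)     (cα , cφ) = cong₂ gneg (renG-closed ρ α cα) (ren-closed ρ φ cφ)
  ren-closed ρ (tc k b xs ys) (cb , bxs , bys) =
    trans (cong (λ b′ → tc k b′ _ _) (ren-closed ρ b cb))
          (cong₂ (tc k b) (map-fixes (renV-bound ρ) bxs) (map-fixes (renV-bound ρ) bys))

  fvVs-closed : ∀ {n m} {xs : Vec Var m} → VAll.All (BoundBelow n) xs → fvVs xs ≡ []
  fvVs-closed VAll.[]              = refl
  fvVs-closed (bv< _ VAll.∷ bxs) = fvVs-closed bxs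

  fvG-closed : ∀ {n} α → ClosedG n α → fvG α ≡ []
  fvG-closed (rel R xs) bxs             = fvVs-closed bxs
  fvG-closed (eq x y)   (bv< _ , bv< _) = refl
  fvG-closed (ex α)     cα              = fvG-closed α cα

  fv-closed : ∀ {n} φ → Closed n φ → fv φ ≡ []
  fv-closed (grd α)        cα               = fvG-closed α cα
  fv-closed (or φ ψ)       (cφ , cψ)        = cong₂ _++_ (fv-closed φ cφ) (fv-closed ψ cψ)
  fv-closed (and φ ψ)      (cφ , cψ)        = cong₂ _++_ (fv-closed φ cφ) (fv-closed ψ cψ)
  fv-closed (ex φ)         cφ               = fv-closed φ cφ
  fv-closed (gneg α φ)     (cα , cφ)        = cong₂ _++_ (fvG-closed α cα) (fv-closed φ cφ)
  fv-closed (tc k b xs ys) (cb , bxs , bys) =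
    cong₂ _++_ (fv-closed b cb) (cong₂ _++_ (fvVs-closed bxs) (fvVs-closed bys))

  dV⇒bound : ∀ {c} e v → All (BoundBelow c) (dV e v) → BoundBelow (e + c) v
  dV⇒bound e (fr x) (() ∷ [])
  dV⇒bound {c} e (bv j) h with j <ᵇ e | <ᵇ-reflects-< j e
  ... | true  | ofʸ j<e = bv< (≤-trans j<e (m≤m+n e c))
  ... | false | ofⁿ j≮e with bv< j∸e<c ∷ [] ← h =
    bv< (subst (_< e + c) (m+[n∸m]≡n (≮⇒≥ j≮e)) (+-monoʳ-< e j∸e<c))

  dVs⇒bound : ∀ {c n} e (xs : Vec Var n) →
              All (BoundBelow c) (dVs e xs) → VAll.All (BoundBelow (e + c)) xs
  dVs⇒bound e Vec.[]       h = VAll.[]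
  dVs⇒bound e (x Vec.∷ xs) h =
    uncurry VAll._∷_ (Product.map (dV⇒bound e x) (dVs⇒bound e xs) (All.++⁻ (dV e x) h))

  dG⇒closed : ∀ {c} e α → All (BoundBelow c) (dG e α) → ClosedG (e + c) α
  dG⇒closed e (rel R xs) h = dVs⇒bound e xs h
  dG⇒closed e (eq x y)   h = Product.map (dV⇒bound e x) (dV⇒bound e y) (All.++⁻ (dV e x) h)
  dG⇒closed e (ex α)     h = dG⇒closed (suc e) α h

  dF⇒closed : ∀ {c} e φ → All (BoundBelow c) (dF e φ) → Closed (e + c) φ
  dF⇒closed e (grd α)    h = dG⇒closed e α h
  dF⇒closed e (or φ ψ)   h = Product.map (dF⇒closed e φ) (dF⇒closed e ψ) (All.++⁻ (dF e φ) h)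
  dF⇒closed e (and φ ψ)  h = Product.map (dF⇒closed e φ) (dF⇒closed e ψ) (All.++⁻ (dF e φ) h)
  dF⇒closed e (ex φ)     h = dF⇒closed (suc e) φ h
  dF⇒closed e (gneg α φ) h = Product.map (dG⇒closed e α) (dF⇒closed e φ) (All.++⁻ (dG e α) h)
  dF⇒closed {c} e (tc k b xs ys) h =
    Product.map body (Product.map (dVs⇒bound e xs) (dVs⇒bound e ys) ∘ All.++⁻ (dVs e xs))
                (All.++⁻ (dF (e + 2 * suc k) b) h)
    where
    swap-tail : ∀ e t c → e + t + c ≡ e + c + t
    swap-tail = solve-∀
    body : All (BoundBelow c) (dF (e + 2 * suc k) b) → Closed (e + c + 2 * suc k) b
    body hb = subst (λ n → Closed n b) (swap-tail e (2 * suc k) c) (dF⇒closed (e + 2 * suc k) b hb)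

  -- What WF guarantees of transitive-closure bodies; it is why they contribute no free-name
  -- occurrences to skeletons.
  BodiesClosed : Formula → Set
  BodiesClosed (grd α)        = ⊤
  BodiesClosed (or φ ψ)       = BodiesClosed φ × BodiesClosed ψ
  BodiesClosed (and φ ψ)      = BodiesClosed φ × BodiesClosed ψ
  BodiesClosed (ex φ)         = BodiesClosed φ
  BodiesClosed (gneg α φ)     = BodiesClosed φ
  BodiesClosed (tc k b xs ys) = Closed (2 * suc k) b × BodiesClosed b

  WF⇒BodiesClosed : ∀ φ → WF φ → BodiesClosed φ
  WF⇒BodiesClosed (grd α)        _           = tt
  WF⇒BodiesClosed (or φ ψ)       (wφ , wψ)   = WF⇒BodiesClosed φ wφ , WF⇒BodiesClosed ψ wψ
  WF⇒BodiesClosed (and φ ψ)      (wφ , wψ)   = WF⇒BodiesClosed φ wφ , WF⇒BodiesClosed ψ wψ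
  WF⇒BodiesClosed (ex φ)         wφ          = WF⇒BodiesClosed φ wφ
  WF⇒BodiesClosed (gneg α φ)     (wφ , _)    = WF⇒BodiesClosed φ wφ
  WF⇒BodiesClosed (tc k b xs ys) (wb , _ , scoped) =
    dF⇒closed 0 b (All.tabulate (λ {v} v∈ → bound (scoped v v∈))) , WF⇒BodiesClosed b wb
    where
    bound : ∀ {v} → ∃ (λ i → i < 2 * suc k × v ≡ bv i) → BoundBelow (2 * suc k) v
    bound (i , i<2m , refl) = bv< i<2m

  BodiesClosed-openF : ∀ d zs φ → BodiesClosed φ → BodiesClosed (openF d zs φ)
  BodiesClosed-openF d zs (grd α)        _         = tt
  BodiesClosed-openF d zs (or φ ψ)       (cφ , cψ) =
    BodiesClosed-openF d zs φ cφ , BodiesClosed-openF d zs ψ cψ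
  BodiesClosed-openF d zs (and φ ψ)      (cφ , cψ) =
    BodiesClosed-openF d zs φ cφ , BodiesClosed-openF d zs ψ cψ
  BodiesClosed-openF d zs (ex φ)         cφ        = BodiesClosed-openF (suc d) zs φ cφ
  BodiesClosed-openF d zs (gneg α φ)     cφ        = BodiesClosed-openF d zs φ cφ
  BodiesClosed-openF d zs (tc k b xs ys) (cb , bb)
    rewrite openF-closed zs b cb (m≤n+m (2 * suc k) d) = cb , bb

  BodiesClosed-ren : ∀ ρ φ → BodiesClosed φ → BodiesClosed (ren ρ φ)
  BodiesClosed-ren ρ (grd α)        _         = tt
  BodiesClosed-ren ρ (or φ ψ)       (cφ , cψ) = BodiesClosed-ren ρ φ cφ , BodiesClosed-ren ρ ψ cψ
  BodiesClosed-ren ρ (and φ ψ)      (cφ , cψ) = BodiesClosed-ren ρ φ cφ , BodiesClosed-ren ρ ψ cψ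
  BodiesClosed-ren ρ (ex φ)         cφ        = BodiesClosed-ren ρ φ cφ
  BodiesClosed-ren ρ (gneg α φ)     cφ        = BodiesClosed-ren ρ φ cφ
  BodiesClosed-ren ρ (tc k b xs ys) (cb , bb) rewrite ren-closed ρ b cb = cb , bb

  BodiesClosed-eqs : ∀ {k} (us vs : Vec Var (suc k)) → BodiesClosed (eqs us vs)
  BodiesClosed-eqs {zero}  (u Vec.∷ Vec.[]) (v Vec.∷ Vec.[]) = tt
  BodiesClosed-eqs {suc k} (u Vec.∷ us)     (v Vec.∷ vs)     = tt , BodiesClosed-eqs us vs

  -- Skeletons

  erase : Formula → Formula
  erase = ren (const 0)

  eraseVs : ∀ {m} → Vec Var m → Vec Var m
  eraseVs = Vec.map (renV (const 0))

  zeros : (m : ℕ) → Vec ℕ m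
  zeros m = Vec.replicate m 0

  zeroNames : (m : ℕ) → Vec Var m
  zeroNames m = names (zeros m)

  erase-names : ∀ {m} (z : Vec ℕ m) → eraseVs (names z) ≡ zeroNames m
  erase-names Vec.[]      = refl
  erase-names (_ Vec.∷ z) = cong (fr 0 Vec.∷_) (erase-names z)

  erase-toList : ∀ {m} (z : Vec ℕ m) → map (const 0) (toList z) ≡ toList (zeros m)
  erase-toList Vec.[]      = refl
  erase-toList (_ Vec.∷ z) = cong (0 ∷_) (erase-toList z)

  tcEnds : ∀ {k} (xs ys z : Vec Var (suc k)) → List Formula
  tcEnds xs ys z = eqs xs ys ∷ eqs xs z ∷ eqs z ys ∷ eqs z z ∷ []

  tcSteps : ∀ {m} → (Vec Var m → Vec Var m → Formula) → (xs ys z₁ z₂ z : Vec Var m) →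
            List Formula → List (List Formula)
  tcSteps T xs ys z₁ z₂ z Γ =
    (Γ ++ [ T z₂ ys ]) ∷ (Γ ++ [ T z₂ z ]) ∷ (T xs z₁ ∷ Γ) ∷ (T z z₁ ∷ Γ) ∷ Γ ∷ []

  -- skeletons f (erase φ) lists every erased member of cl(φ) once the fuel f exceeds size φ;
  -- fuel is needed because the recursion passes through openF and eqs.
  skeletons : ℕ → Formula → List (List Formula)
  skeletons zero    _              = []
  skeletons (suc f) (grd α)        = [ grd α ] ∷ [] ∷ []
  skeletons (suc f) (or φ ψ)       = [ or φ ψ ] ∷ skeletons f φ ++ skeletons f ψ
  skeletons (suc f) (and φ ψ)      =
    [ and φ ψ ] ∷ cartesianProductWith _++_ (skeletons f φ) (skeletons f ψ)
  skeletons (suc f) (ex φ)         = [ ex φ ] ∷ skeletons f (openF 0 [ 0 ] φ)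
  skeletons (suc f) (gneg α φ)     = [ gneg α φ ] ∷ skeletons f φ
  skeletons (suc f) (tc k b xs ys) =
    [ tc k b xs ys ] ∷
      concatMap (skeletons f) (tcEnds xs ys (zeroNames (suc k)))
      ++ concatMap (tcSteps (tc k b) xs ys (zeroNames (suc k)) (zeroNames (suc k)) (zeroNames (suc k)))
                   (skeletons f (openF 0 (toList (zeros (suc k)) ++ toList (zeros (suc k))) b))

  module _ {f k : ℕ} {b : Formula} {xs ys : Vec Var (suc k)} where
    private
      Z = zeroNames (suc k)
      zs = toList (zeros (suc k))
      ends = concatMap (skeletons f) (tcEnds xs ys Z)
      body = skeletons f (openF 0 (zs ++ zs) b)

    ∈-tc-ends : ∀ {χ Γ} → χ ∈ tcEnds xs ys Z → Γ ∈ skeletons f χ →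
                Γ ∈ skeletons (suc f) (tc k b xs ys)
    ∈-tc-ends χ∈ Γ∈ =
      there (∈-++⁺ˡ {xs = ends} (∈-concatMap⁺ (skeletons f) {xs = tcEnds xs ys Z}
                                              (Any.map (λ { refl → Γ∈ }) χ∈)))

    ∈-tc-steps : ∀ {Γ Δ} → Γ ∈ body → Δ ∈ tcSteps (tc k b) xs ys Z Z Z Γ →
                 Δ ∈ skeletons (suc f) (tc k b xs ys)
    ∈-tc-steps Γ∈ Δ∈ =
      there (∈-++⁺ʳ ends (∈-concatMap⁺ (tcSteps (tc k b) xs ys Z Z Z) {xs = body}
                                       (Any.map (λ { refl → Δ∈ }) Γ∈)))

  erase-TCStep : ∀ {k b} {xs ys : Vec Var (suc k)} {z₁ z₂ z Γ Δ} →
                 TCStep (tc k b) xs ys z₁ z₂ z Γ Δ →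
                 let Z = zeroNames (suc k) in
                 map erase Δ ∈ tcSteps (tc k (erase b)) (eraseVs xs) (eraseVs ys) Z Z Z (map erase Γ)
  erase-TCStep {k} {b} {ys = ys} {z₂ = z₂} {Γ = Γ} step₁
    rewrite map-++ erase Γ [ tc k b (names z₂) ys ] | erase-names z₂ = here refl
  erase-TCStep {k} {b} {z₂ = z₂} {z} {Γ} step₂
    rewrite map-++ erase Γ [ tc k b (names z₂) (names z) ] | erase-names z₂ | erase-names z =
    there (here refl)
  erase-TCStep {z₁ = z₁} step₃ rewrite erase-names z₁ = there (there (here refl))
  erase-TCStep {z₁ = z₁} {z = z} step₄
    rewrite erase-names z₁ | erase-names z = there (there (there (here refl)))
  erase-TCStep step₅ = there (there (there (there (here refl))))

  skeleton-∈ : ∀ {f φ Γ} → Cl φ Γ → size φ < f → map erase Γ ∈ skeletons f (erase φ)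
  skeleton-∈ {zero} _ ()
  skeleton-∈ {suc f} grd-self  _ = here refl
  skeleton-∈ {suc f} grd-empty _ = there (here refl)
  skeleton-∈ {suc f} or-self   _ = here refl
  skeleton-∈ {suc f} (or-l {φ} {ψ} c) lt =
    there (∈-++⁺ˡ (skeleton-∈ c (m<n⇒n<1+o⇒m<o (size-<-orˡ φ ψ) lt)))
  skeleton-∈ {suc f} (or-r {φ} {ψ} c) lt =
    there (∈-++⁺ʳ (skeletons f (erase φ)) (skeleton-∈ c (m<n⇒n<1+o⇒m<o (size-<-orʳ φ ψ) lt)))
  skeleton-∈ {suc f} and-self _ = here refl
  skeleton-∈ {suc f} (and-split {φ} {ψ} {Γ} {Δ} cΓ cΔ _) lt rewrite map-++ erase Γ Δ =
    there (∈-cartesianProductWith⁺ _++_ (skeleton-∈ cΓ (m<n⇒n<1+o⇒m<o (size-<-andˡ φ ψ) lt))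
                                        (skeleton-∈ cΔ (m<n⇒n<1+o⇒m<o (size-<-andʳ φ ψ) lt)))
  skeleton-∈ {suc f} ex-self _ = here refl
  skeleton-∈ {suc f} (ex-inst {φ} {Γ} z _ c) lt =
    there (subst (λ χ → map erase Γ ∈ skeletons f χ) (ren-openF (const 0) 0 [ z ] φ)
                 (skeleton-∈ c (m<n⇒n<1+o⇒m<o (size-<-ex [ z ] φ) lt)))
  skeleton-∈ {suc f} gneg-self _ = here refl
  skeleton-∈ {suc f} (gneg-sub {α} {φ} c) lt =
    there (skeleton-∈ c (m<n⇒n<1+o⇒m<o (size-<-gneg α φ) lt))
  skeleton-∈ {suc f} tc-self _ = here refl
  skeleton-∈ {suc f} (tc-xy {k} {b} {xs} {ys} c) lt
    with skeleton-∈ c (m<n⇒n<1+o⇒m<o (size-<-tc-eqs b xs ys xs ys) lt)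
  ... | h rewrite ren-eqs (const 0) xs ys = ∈-tc-ends (here refl) h
  skeleton-∈ {suc f} (tc-xz {k} {b} {xs} {ys} z _ _ _ c) lt
    with skeleton-∈ c (m<n⇒n<1+o⇒m<o (size-<-tc-eqs b xs ys xs (names z)) lt)
  ... | h rewrite ren-eqs (const 0) xs (names z) | erase-names z =
    ∈-tc-ends (there (here refl)) h
  skeleton-∈ {suc f} (tc-zy {k} {b} {xs} {ys} z _ _ _ c) lt
    with skeleton-∈ c (m<n⇒n<1+o⇒m<o (size-<-tc-eqs b xs ys (names z) ys) lt)
  ... | h rewrite ren-eqs (const 0) (names z) ys | erase-names z =
    ∈-tc-ends (there (there (here refl))) h
  skeleton-∈ {suc f} (tc-zz {k} {b} {xs} {ys} z z′ _ _ c) lt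
    with skeleton-∈ c (m<n⇒n<1+o⇒m<o (size-<-tc-eqs b xs ys (names z) (names z′)) lt)
  ... | h rewrite ren-eqs (const 0) (names z) (names z′) | erase-names z | erase-names z′ =
    ∈-tc-ends (there (there (there (here refl)))) h
  skeleton-∈ {suc f} (tc-step {k} {b} {xs} {ys} z₁ z₂ z _ _ c _ step) lt
    with skeleton-∈ c (m<n⇒n<1+o⇒m<o (size-<-tc-body b xs ys (toList z₁ ++ toList z₂)) lt)
  ... | h rewrite ren-openF (const 0) 0 (toList z₁ ++ toList z₂) b
                | map-++ (const 0) (toList z₁) (toList z₂) | erase-toList z₁ | erase-toList z₂ =
    ∈-tc-steps h (erase-TCStep step)

  2≤2^size : ∀ φ → 2 ≤ 2 ^ size φ
  2≤2^size φ = ^-monoʳ-≤ 2 (size>0 φ)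

  length-skeletons : ∀ f φ → length (skeletons f φ) ≤ 2 ^ size φ
  length-skeletons zero    φ       = z≤n
  length-skeletons (suc f) (grd α) = ^-monoʳ-≤ 2 (sizeG>0 α)
  length-skeletons (suc f) (or φ ψ) = m≤2^n⇒1+m≤2^[1+n] (size φ + size ψ) (begin
    length (skeletons f φ ++ skeletons f ψ)
      ≤⟨ length-++-≤ (skeletons f φ) _ (length-skeletons f φ) (length-skeletons f ψ) ⟩
    2 ^ size φ + 2 ^ size ψ  ≤⟨ m+n≤m*n (2≤2^size φ) (2≤2^size ψ) ⟩
    2 ^ size φ * 2 ^ size ψ  ≡⟨ ^-distribˡ-+-* 2 (size φ) (size ψ) ⟨
    2 ^ (size φ + size ψ)    ∎)
    where open ≤-Reasoning
  length-skeletons (suc f) (and φ ψ) = m≤2^n⇒1+m≤2^[1+n] (size φ + size ψ) (begin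
    length (cartesianProductWith _++_ (skeletons f φ) (skeletons f ψ))
      ≡⟨ length-cartesianProductWith _++_ (skeletons f φ) (skeletons f ψ) ⟩
    length (skeletons f φ) * length (skeletons f ψ)
      ≤⟨ *-mono-≤ (length-skeletons f φ) (length-skeletons f ψ) ⟩
    2 ^ size φ * 2 ^ size ψ  ≡⟨ ^-distribˡ-+-* 2 (size φ) (size ψ) ⟨
    2 ^ (size φ + size ψ)    ∎)
    where open ≤-Reasoning
  length-skeletons (suc f) (ex φ) =
    ≤-trans (m≤2^n⇒1+m≤2^[1+n] (size (openF 0 [ 0 ] φ)) (length-skeletons f (openF 0 [ 0 ] φ)))
            (^-monoʳ-≤ 2 (size-<-ex [ 0 ] φ))
  length-skeletons (suc f) (gneg α φ) =
    ≤-trans (m≤2^n⇒1+m≤2^[1+n] (size φ) (length-skeletons f φ)) (^-monoʳ-≤ 2 (size-<-gneg α φ))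
  length-skeletons (suc f) (tc k b xs ys) = begin
    suc (length (ends ++ steps))                ≤⟨ s≤s (length-++-≤ ends steps ends≤ steps≤) ⟩
    suc (4 * 2 ^ (4 * suc k) + 2 ^ size b * 5) ≤⟨ 1+4m+5n≤8mn 2≤2^[4k+4] (2≤2^size b) ⟩
    2 ^ (3 + 4 * suc k) * 2 ^ size b            ≡⟨ ^-distribˡ-+-* 2 (3 + 4 * suc k) (size b) ⟨
    2 ^ size (tc k b xs ys)                     ∎
    where
    open ≤-Reasoning
    Z = zeroNames (suc k)
    zs = toList (zeros (suc k))
    ends = concatMap (skeletons f) (tcEnds xs ys Z)
    steps = concatMap (tcSteps (tc k b) xs ys Z Z Z) (skeletons f (openF 0 (zs ++ zs) b))
    2≤2^[4k+4] : 2 ≤ 2 ^ (4 * suc k)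
    2≤2^[4k+4] = ^-monoʳ-≤ 2 {1} {4 * suc k} (s≤s z≤n)
    eqs≤ : ∀ us vs → length (skeletons f (eqs us vs)) ≤ 2 ^ (4 * suc k)
    eqs≤ us vs = ≤-trans (length-skeletons f (eqs us vs)) (^-monoʳ-≤ 2 (size-eqs us vs))
    ends≤ : length ends ≤ 4 * 2 ^ (4 * suc k)
    ends≤ = length-concatMap-≤ (skeletons f) (eqs≤ xs ys ∷ eqs≤ xs Z ∷ eqs≤ Z ys ∷ eqs≤ Z Z ∷ [])
    body≤ : length (skeletons f (openF 0 (zs ++ zs) b)) ≤ 2 ^ size b
    body≤ = ≤-trans (length-skeletons f _) (≤-reflexive (cong (2 ^_) (size-openF 0 (zs ++ zs) b)))
    steps≤ : length steps ≤ 2 ^ size b * 5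
    steps≤ = ≤-trans (length-concatMap-≤ (tcSteps (tc k b) xs ys Z Z Z) {c = 5}
                                         (All.universal (λ _ → ≤-refl) (skeletons f (openF 0 (zs ++ zs) b))))
                     (*-monoˡ-≤ 5 body≤)

  record Occurrences≤ (n : ℕ) (Γ : List Formula) : Set where
    constructor occurrences≤
    field length-fvL≤ : length (fvL Γ) ≤ n
  open Occurrences≤

  Occurrences≤-weaken : ∀ {a b} → a ≤ b → ∀ {Ss} →
                        All (Occurrences≤ a) Ss → All (Occurrences≤ b) Ss
  Occurrences≤-weaken a≤b = All.map (λ (occurrences≤ occ) → occurrences≤ (≤-trans occ a≤b))

  Occurrences≤-++ : ∀ {a b Γ Δ} → Occurrences≤ a Γ → Occurrences≤ b Δ →
                    Occurrences≤ (a + b) (Γ ++ Δ)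
  Occurrences≤-++ {a} {b} {Γ} {Δ} (occurrences≤ occΓ) (occurrences≤ occΔ) = occurrences≤
    (subst (λ l → length l ≤ a + b) (sym (concatMap-++ fv Γ Δ))
           (length-++-≤ (fvL Γ) (fvL Δ) occΓ occΔ))

  Occurrences≤-[_] : ∀ φ → Occurrences≤ (size φ) [ φ ]
  Occurrences≤-[ φ ] =
    occurrences≤ (subst (λ l → length l ≤ size φ) (sym (++-identityʳ (fv φ))) (length-fv φ))

  Occurrences≤-tc : ∀ {n k b} → Closed n b → (us vs : Vec Var (suc k)) →
                    Occurrences≤ (suc k + suc k) [ tc k b us vs ]
  Occurrences≤-tc {k = k} {b} cb us vs = occurrences≤ (begin
    length ((fv b ++ fvVs us ++ fvVs vs) ++ [])
      ≡⟨ cong length (++-identityʳ (fv b ++ fvVs us ++ fvVs vs)) ⟩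
    length (fv b ++ fvVs us ++ fvVs vs)
      ≡⟨ cong (λ l → length (l ++ fvVs us ++ fvVs vs)) (fv-closed b cb) ⟩
    length (fvVs us ++ fvVs vs)
      ≤⟨ length-++-≤ (fvVs us) _ (length-fvVs us) (length-fvVs vs) ⟩
    suc k + suc k ∎)
    where open ≤-Reasoning

  tcSteps-occurrences : ∀ {m a c} {T : Vec Var m → Vec Var m → Formula} {xs ys z₁ z₂ z Γ} →
                        Occurrences≤ a Γ → (∀ us vs → Occurrences≤ c [ T us vs ]) →
                        All (Occurrences≤ (a + c)) (tcSteps T xs ys z₁ z₂ z Γ)
  tcSteps-occurrences {a = a} {c} {xs = xs} {ys} {z₁} {z₂} {z} occΓ occT =
    Occurrences≤-++ occΓ (occT z₂ ys) ∷ Occurrences≤-++ occΓ (occT z₂ z)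
    ∷ commute (Occurrences≤-++ (occT xs z₁) occΓ) ∷ commute (Occurrences≤-++ (occT z z₁) occΓ)
    ∷ occurrences≤ (≤-trans (length-fvL≤ occΓ) (m≤m+n a c)) ∷ []
    where
    commute : ∀ {Δ} → Occurrences≤ (c + a) Δ → Occurrences≤ (a + c) Δ
    commute (occurrences≤ occ) = occurrences≤ (≤-trans occ (≤-reflexive (+-comm c a)))

  skeletons-occurrences : ∀ f φ → BodiesClosed φ → All (Occurrences≤ (size φ)) (skeletons f φ)
  skeletons-occurrences zero    φ       _ = []
  skeletons-occurrences (suc f) (grd α) _ = Occurrences≤-[ grd α ] ∷ occurrences≤ z≤n ∷ []
  skeletons-occurrences (suc f) (or φ ψ) (cφ , cψ) =
    Occurrences≤-[ or φ ψ ] ∷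
    All.++⁺ (Occurrences≤-weaken (<⇒≤ (size-<-orˡ φ ψ)) (skeletons-occurrences f φ cφ))
            (Occurrences≤-weaken (<⇒≤ (size-<-orʳ φ ψ)) (skeletons-occurrences f ψ cψ))
  skeletons-occurrences (suc f) (and φ ψ) (cφ , cψ) =
    Occurrences≤-[ and φ ψ ] ∷
    Occurrences≤-weaken (n≤1+n _)
      (All.cartesianProductWith⁺ (setoid _) (setoid _) _++_ (skeletons f φ) (skeletons f ψ)
        (λ Γ∈ Δ∈ → Occurrences≤-++ (All.lookup (skeletons-occurrences f φ cφ) Γ∈)
                                   (All.lookup (skeletons-occurrences f ψ cψ) Δ∈)))
  skeletons-occurrences (suc f) (ex φ) cφ =
    Occurrences≤-[ ex φ ] ∷
    Occurrences≤-weaken (<⇒≤ (size-<-ex [ 0 ] φ))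
      (skeletons-occurrences f (openF 0 [ 0 ] φ) (BodiesClosed-openF 0 [ 0 ] φ cφ))
  skeletons-occurrences (suc f) (gneg α φ) cφ =
    Occurrences≤-[ gneg α φ ] ∷
    Occurrences≤-weaken (<⇒≤ (size-<-gneg α φ)) (skeletons-occurrences f φ cφ)
  skeletons-occurrences (suc f) (tc k b xs ys) (cb , bb) =
    Occurrences≤-[ tc k b xs ys ] ∷ All.++⁺ ends steps
    where
    Z = zeroNames (suc k)
    zs = toList (zeros (suc k))
    end : ∀ us vs → All (Occurrences≤ (size (tc k b xs ys))) (skeletons f (eqs us vs))
    end us vs = Occurrences≤-weaken (<⇒≤ (size-<-tc-eqs b xs ys us vs))
                  (skeletons-occurrences f (eqs us vs) (BodiesClosed-eqs us vs))
    ends : All (Occurrences≤ (size (tc k b xs ys))) (concatMap (skeletons f) (tcEnds xs ys Z))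
    ends = All.concat⁺ (All.map⁺ {f = skeletons f} (end xs ys ∷ end xs Z ∷ end Z ys ∷ end Z Z ∷ []))
    body : All (Occurrences≤ (size b)) (skeletons f (openF 0 (zs ++ zs) b))
    body = Occurrences≤-weaken (≤-reflexive (size-openF 0 (zs ++ zs) b))
             (skeletons-occurrences f (openF 0 (zs ++ zs) b) (BodiesClosed-openF 0 (zs ++ zs) b bb))
    steps : All (Occurrences≤ (size (tc k b xs ys)))
                (concatMap (tcSteps (tc k b) xs ys Z Z Z) (skeletons f (openF 0 (zs ++ zs) b)))
    steps = Occurrences≤-weaken (size-body+2m-≤-tc b xs ys)
              (All.concat⁺ (All.map⁺ {f = tcSteps (tc k b) xs ys Z Z Z}
                (All.map (λ occΓ → tcSteps-occurrences occΓ (Occurrences≤-tc cb)) body)))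

  erase-skeletons-occurrences : ∀ φ → BodiesClosed φ →
                                All (Occurrences≤ (size φ)) (skeletons (suc (size φ)) (erase φ))
  erase-skeletons-occurrences φ cφ =
    subst (λ s → All (Occurrences≤ s) (skeletons (suc (size φ)) (erase φ))) (size-ren (const 0) φ)
          (skeletons-occurrences (suc (size φ)) (erase φ) (BodiesClosed-ren (const 0) φ cφ))

  -- Refilling skeletons

  Filler : Set → Set
  Filler A = List ℕ → A × List ℕ

  fill₁ : ∀ {A B} → (A → B) → Filler A → Filler B
  fill₁ f p ws = Product.map₁ f (p ws)

  fill₂ : ∀ {A B C} → (A → B → C) → Filler A → Filler B → Filler C
  fill₂ f p q ws = let (a , ws′) = p ws in Product.map₁ (f a) (q ws′)

  fillV : Var → Filler Var
  fillV (fr x) []       = fr x , []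
  fillV (fr x) (w ∷ ws) = fr w , ws
  fillV (bv i) ws       = bv i , ws

  fillVs : ∀ {n} → Vec Var n → Filler (Vec Var n)
  fillVs Vec.[]       ws = Vec.[] , ws
  fillVs (x Vec.∷ xs)    = fill₂ Vec._∷_ (fillV x) (fillVs xs)

  fillG : Guard → Filler Guard
  fillG (rel R xs) = fill₁ (rel R) (fillVs xs)
  fillG (eq x y)   = fill₂ eq (fillV x) (fillV y)
  fillG (ex α)     = fill₁ ex (fillG α)

  fillF : Formula → Filler Formula
  fillF (grd α)        = fill₁ grd (fillG α)
  fillF (or φ ψ)       = fill₂ or (fillF φ) (fillF ψ)
  fillF (and φ ψ)      = fill₂ and (fillF φ) (fillF ψ)
  fillF (ex φ)         = fill₁ ex (fillF φ)
  fillF (gneg α φ)     = fill₂ gneg (fillG α) (fillF φ)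
  fillF (tc k b xs ys) =
    fill₂ (λ b′ → uncurry (tc k b′)) (fillF b) (fill₂ _,_ (fillVs xs) (fillVs ys))

  fillL : List Formula → Filler (List Formula)
  fillL []      ws = [] , ws
  fillL (φ ∷ Γ)    = fill₂ _∷_ (fillF φ) (fillL Γ)

  record Decodes {A : Set} (p : Filler A) (ws : List ℕ) (a : A) : Set where
    constructor decodes
    field decode : ∀ rest → p (ws ++ rest) ≡ (a , rest)
  open Decodes

  fill₁-decodes : ∀ {A B} (f : A → B) {p ws a} → Decodes p ws a → Decodes (fill₁ f p) ws (f a)
  fill₁-decodes f (decodes dec) = decodes λ rest → cong (Product.map₁ f) (dec rest)

  fill₂-decodes : ∀ {A B C} (f : A → B → C) {p q ws ws′ a b} →
                  Decodes p ws a → Decodes q ws′ b → Decodes (fill₂ f p q) (ws ++ ws′) (f a b)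
  fill₂-decodes f {p} {q} {ws} {ws′} {a} {b} (decodes decp) (decodes decq) = decodes λ rest → begin
    fill₂ f p q ((ws ++ ws′) ++ rest)     ≡⟨ cong (fill₂ f p q) (++-assoc ws ws′ rest) ⟩
    fill₂ f p q (ws ++ ws′ ++ rest)
      ≡⟨ cong (λ (a′ , rest′) → Product.map₁ (f a′) (q rest′)) (decp (ws′ ++ rest)) ⟩
    Product.map₁ (f a) (q (ws′ ++ rest))  ≡⟨ cong (Product.map₁ (f a)) (decq rest) ⟩
    (f a b , rest)                        ∎
    where open ≡-Reasoning

  module _ (τ ρ : ℕ → ℕ) where

    fillV-ren : ∀ v → Decodes (fillV (renV τ v)) (fvV (renV ρ v)) (renV ρ v)
    fillV-ren (fr x) = decodes λ _ → refl
    fillV-ren (bv i) = decodes λ _ → refl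

    fillVs-ren : ∀ {n} (xs : Vec Var n) →
                 Decodes (fillVs (Vec.map (renV τ) xs)) (fvVs (Vec.map (renV ρ) xs))
                         (Vec.map (renV ρ) xs)
    fillVs-ren Vec.[]       = decodes λ _ → refl
    fillVs-ren (x Vec.∷ xs) = fill₂-decodes Vec._∷_ (fillV-ren x) (fillVs-ren xs)

    fillG-ren : ∀ α → Decodes (fillG (renG τ α)) (fvG (renG ρ α)) (renG ρ α)
    fillG-ren (rel R xs) = fill₁-decodes (rel R) (fillVs-ren xs)
    fillG-ren (eq x y)   = fill₂-decodes eq (fillV-ren x) (fillV-ren y)
    fillG-ren (ex α)     = fill₁-decodes ex (fillG-ren α)

    fillF-ren : ∀ φ → Decodes (fillF (ren τ φ)) (fv (ren ρ φ)) (ren ρ φ)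
    fillF-ren (grd α)        = fill₁-decodes grd (fillG-ren α)
    fillF-ren (or φ ψ)       = fill₂-decodes or (fillF-ren φ) (fillF-ren ψ)
    fillF-ren (and φ ψ)      = fill₂-decodes and (fillF-ren φ) (fillF-ren ψ)
    fillF-ren (ex φ)         = fill₁-decodes ex (fillF-ren φ)
    fillF-ren (gneg α φ)     = fill₂-decodes gneg (fillG-ren α) (fillF-ren φ)
    fillF-ren (tc k b xs ys) =
      fill₂-decodes (λ b′ → uncurry (tc k b′)) (fillF-ren b)
                    (fill₂-decodes _,_ (fillVs-ren xs) (fillVs-ren ys))

    fillL-ren : ∀ Γ → Decodes (fillL (map (ren τ) Γ)) (fvL (map (ren ρ) Γ)) (map (ren ρ) Γ)
    fillL-ren []      = decodes λ _ → refl
    fillL-ren (φ ∷ Γ) = fill₂-decodes _∷_ (fillF-ren φ) (fillL-ren Γ)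

  refill : List Formula → List ℕ → List Formula
  refill S ws = proj₁ (fillL S ws)

  refill-erase : ∀ ρ Γ → refill (map erase Γ) (map ρ (fvL Γ)) ≡ map (ren ρ) Γ
  refill-erase ρ Γ = begin
    refill S (map ρ (fvL Γ))              ≡⟨ cong (refill S) (fvL-ren ρ Γ) ⟨
    refill S (fvL (map (ren ρ) Γ))        ≡⟨ cong (refill S) (++-identityʳ _) ⟨
    refill S (fvL (map (ren ρ) Γ) ++ [])  ≡⟨ cong proj₁ (decode (fillL-ren (const 0) ρ Γ) []) ⟩
    map (ren ρ) Γ                         ∎
    where
    open ≡-Reasoning
    S = map erase Γ

  -- Canonical representatives

  fillings : ℕ → List Formula → List (List Formula)
  fillings n S = map (refill S) (words (length (fvL S)) n)

  representatives : Formula → List (List Formula)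
  representatives φ = concatMap (fillings (size φ)) (skeletons (suc (size φ)) (erase φ))

  canonical : List Formula → List Formula
  canonical Γ = map (ren (position (fvL Γ))) Γ

  ≈ren-canonical : ∀ Γ → Γ ≈ren canonical Γ
  ≈ren-canonical Γ = position (fvL Γ) , position-injective (fvL Γ) , K-refl

  length-fillings : ∀ {n S} .{{_ : NonZero n}} → Occurrences≤ n S → length (fillings n S) ≤ n ^ n
  length-fillings {n} {S} (occurrences≤ occ) = begin
    length (fillings n S)               ≡⟨ length-map (refill S) (words (length (fvL S)) n) ⟩
    length (words (length (fvL S)) n)   ≡⟨ length-words (length (fvL S)) n ⟩
    n ^ length (fvL S)                  ≤⟨ ^-monoʳ-≤ n occ ⟩
    n ^ n                               ∎
    where open ≤-Reasoning

  length-representatives : ∀ φ → BodiesClosed φ →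
                           length (representatives φ) ≤ (2 * size φ) ^ (2 * size φ)
  length-representatives φ cφ = begin
    length (representatives φ)
      ≤⟨ length-concatMap-≤ (fillings n) (All.map length-fillings (erase-skeletons-occurrences φ cφ)) ⟩
    length (skeletons (suc n) (erase φ)) * n ^ n
      ≤⟨ *-monoˡ-≤ (n ^ n) skeletons≤ ⟩
    2 ^ n * n ^ n
      ≤⟨ 2ⁿ*nⁿ≤[2n]^[2n] n ⟩
    (2 * n) ^ (2 * n) ∎
    where
    open ≤-Reasoning
    n = size φ
    instance
      n≢0 : NonZero n
      n≢0 = >-nonZero (size>0 φ)
    skeletons≤ : length (skeletons (suc n) (erase φ)) ≤ 2 ^ n
    skeletons≤ = ≤-trans (length-skeletons (suc n) (erase φ))
                         (≤-reflexive (cong (2 ^_) (size-ren (const 0) φ)))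

  canonical-∈ : ∀ {φ Γ} → BodiesClosed φ → Cl φ Γ → canonical Γ ∈ representatives φ
  canonical-∈ {φ} {Γ} cφ c = ∈-concatMap⁺ (fillings n) (Any.map (λ { refl → canonical∈ }) S∈)
    where
    n = size φ
    O = fvL Γ
    ρ = position O
    S = map erase Γ
    S∈ : S ∈ skeletons (suc n) (erase φ)
    S∈ = skeleton-∈ c ≤-refl
    length-fvL-S : length (fvL S) ≡ length O
    length-fvL-S = trans (cong length (fvL-ren (const 0) Γ)) (length-map (const 0) O)
    O≤n : length O ≤ n
    O≤n = subst (_≤ n) length-fvL-S (length-fvL≤ (All.lookup (erase-skeletons-occurrences φ cφ) S∈))
    word∈ : map ρ O ∈ words (length (fvL S)) n
    word∈ = subst (λ L → map ρ O ∈ words L n) (trans (length-map ρ O) (sym length-fvL-S))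
              (∈-words (map ρ O) (All.map⁺ (All.tabulate (λ x∈O → <-≤-trans (position-< x∈O) O≤n))))
    canonical∈ : canonical Γ ∈ fillings n S
    canonical∈ = subst (_∈ fillings n S) (refill-erase ρ Γ) (∈-map⁺ (refill S) word∈)

open GNTCClosure
  using (representatives; length-representatives; canonical-∈; ≈ren-canonical; WF⇒BodiesClosed)

proposition9 : (σ : Signature) → let open Syntax σ in
    (φ : Formula) → GNTC φ →
    Σ (List (List Formula)) λ reps →
      length reps ≤ (2 * size φ) ^ (2 * size φ)
      × (∀ Γ → Cl φ Γ → Any (λ Δ → Γ ≈ren Δ) reps)
proposition9 σ φ (wf , _) =
  representatives σ φ , length-representatives σ φ cφ ,
  λ Γ c → Any.map (λ { refl → ≈ren-canonical σ Γ }) (canonical-∈ σ cφ c)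
  where cφ = WF⇒BodiesClosed σ φ wf
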